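{- Let $r\ge1$, let $\theta=\alpha_1+\cdots+\alpha_r$ be the highest root of $\mathfrak{sl}_{r+1}(\mathbb{C})$, and let $I\subseteq[r]$ be nonempty. For $i\in[r]$: if $i\in I\cup\{1,r\}$ then $s_i\notin\mathcal{A}(\theta,\alpha_I)$; otherwise $s_i\in\mathcal{A}(\theta,\alpha_I)$.
   Context: Notation: $[n]=\{1,\dots,n\}$. In $\mathfrak{sl}_{r+1}(\mathbb{C})$ the simple roots are $\alpha_i=e_i-e_{i+1}$ ($i\in[r]$), the positive roots are $\alpha_i+\cdots+\alpha_j$ ($1\le i\le j\le r$), $\rho$ is half the sum of positive roots, and the Weyl group $W\cong\mathfrak{S}_{r+1}$ is generated by the simple reflections $s_i$. Kostant's partition function $\wp(\xi)$ is the number of ways to write $\xi$ as a nonnegative integral sum of positive roots. The Weyl alternation set is $\mathcal{A}(\lambda,\mu)=\{\sigma\in W:\wp(\sigma(\lambda+\rho)-\rho-\mu)>0\}$. For $I\subseteq[r]$, $\alpha_I=\sum_{i\in I}\alpha_i$. -}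

module Defs where

open import Data.Nat as ℕ using (ℕ; zero; suc; _<_)
open import Data.Integer as ℤ using (ℤ; +_; _-_; _*_; ∣_∣)
open import Data.Fin as Fin using (Fin; toℕ; inject₁)
open import Data.Fin.Subset using (Subset; _∈_)
open import Data.Fin.Permutation using (Permutation′; _⟨$⟩ˡ_; transpose)
open import Data.List using (List; []; _∷_; [_]; map; concatMap; upTo; allFin; foldr)
open import Data.Nat.ListAction using (sum)
open import Data.Vec as Vec using (lookup)
open import Data.Bool using (Bool; true; false; if_then_else_; _∧_)
open import Relation.Nullary.Decidable using (⌊_⌋)

-- Weights of sl_{r+1} in the standard coordinates e_1,…,e_{r+1}
-- (here indexed by Fin (suc r), 0-based).
Wt : ℕ → Set
Wt r = Fin (suc r) → ℤ

_⊕_ : ∀ {r} → Wt r → Wt r → Wt r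
(u ⊕ v) k = u k ℤ.+ v k

_⊖_ : ∀ {r} → Wt r → Wt r → Wt r
(u ⊖ v) k = u k - v k

zeroWt : ∀ {r} → Wt r
zeroWt _ = + 0

e : ∀ {r} → Fin (suc r) → Wt r
e i k = if ⌊ i Fin.≟ k ⌋ then + 1 else + 0

rootE : ∀ {r} → Fin (suc r) → Fin (suc r) → Wt r
rootE i j = e i ⊖ e j

posRoots : (r : ℕ) → List (Wt r)
posRoots r = concatMap (λ i → concatMap (λ j → if ⌊ i Fin.<? j ⌋ then [ rootE i j ] else [])
                                        (allFin (suc r)))
                       (allFin (suc r))

-- simple root α_i = e_i - e_{i+1}, i ∈ [r] (0-based: i : Fin r)
α : ∀ {r} → Fin r → Wt r
α i = rootE (inject₁ i) (Fin.suc i)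

αSet : ∀ {r} → Subset r → Wt r
αSet {r} I = foldr (λ i acc → if lookup I i then α i ⊕ acc else acc) zeroWt (allFin r)

-- highest root θ = α_1 + ⋯ + α_r = e_1 - e_{r+1}
θ : ∀ r → Wt r
θ r = rootE Fin.zero (Fin.fromℕ r)

-- ρ shifted by a multiple of (1,…,1): ρ' = (r, r-1, …, 0).
-- The true ρ = (r/2, r/2 - 1, …, -r/2) = ρ' - (r/2)(1,…,1); since W fixes (1,…,1),
-- σ(λ+ρ)-ρ = σ(λ+ρ')-ρ' for every σ ∈ W.
ρ : ∀ r → Wt r
ρ r k = + (r ℕ.∸ toℕ k)

-- Weyl group W ≅ S_{r+1}, acting by permuting coordinates: σ(e_i) = e_{σ(i)}
W : ℕ → Set
W r = Permutation′ (suc r)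

_·_ : ∀ {r} → W r → Wt r → Wt r
(σ · v) k = v (σ ⟨$⟩ˡ k)

s : ∀ {r} → Fin r → W r
s i = transpose (inject₁ i) (Fin.suc i)

isZero : ∀ {r} → Wt r → Bool
isZero {r} v = foldr (λ k acc → ⌊ v k ℤ.≟ + 0 ⌋ ∧ acc) true (allFin (suc r))

-- height of ξ in simple-root coordinates: ξ = Σ c_i α_i with c_i = ξ_1 + ⋯ + ξ_i
height : ∀ {r} → Wt r → ℤ
height {r} ξ = sum′ (map (λ i → sum′ (map (λ k → ξ k) (prefix i))) (allFin r))
  where
    sum′ : List ℤ → ℤ
    sum′ = foldr ℤ._+_ (+ 0)
    prefix : Fin r → List (Fin (suc r))
    prefix i = concatMap (λ k → if ⌊ toℕ k ℕ.≤? toℕ i ⌋ then [ k ] else []) (allFin (suc r))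

countBounded : ∀ {r} → List (Wt r) → ℕ → Wt r → ℕ
countBounded []       b ξ = if isZero ξ then 1 else 0
countBounded (β ∷ βs) b ξ =
  sum (map (λ m → countBounded βs b (λ k → ξ k - + m * β k)) (upTo (suc b)))

-- Kostant's partition function. Every positive root has height ≥ 1, so in any
-- expression ξ = Σ m_β β each m_β ≤ height ξ; hence the bound is harmless.
℘ : ∀ {r} → Wt r → ℕ
℘ {r} ξ = countBounded (posRoots r) ∣ height ξ ∣ ξ

_∈𝒜[_,_] : ∀ {r} → W r → Wt r → Wt r → Set
_∈𝒜[_,_] {r} σ λ' μ = 0 < ℘ (((σ · (λ' ⊕ ρ r)) ⊖ ρ r) ⊖ μ)

-- Write ϖ i = e_1 + ⋯ + e_i for the i-th fundamental coweight, so that ⟨ ϖ i , ξ ⟩ is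
-- the α_i-coordinate of ξ.  By the reflection formula s_i·λ = λ - ⟨λ + ρ, α_i^∨⟩ α_i,
-- the weight ξ = s_i·θ - α_I has α_j-coordinate 1 - (1 + ⟨θ, α_i^∨⟩) δ_ij - [j ∈ I],
-- where ⟨θ, α_i^∨⟩ = [i = 1] + [i = r].
--   If i ∈ I ∪ {1, r}, the α_i-coordinate of ξ is negative.  Every positive root pairs
-- nonnegatively with ϖ i, hence so does every ξ with ℘ ξ > 0; so ℘ ξ = 0.
--   Otherwise ξ = Σ_{j ∉ I ∪ {i}} α_j is a sum of distinct simple roots, which is itself a
-- partition of ξ into positive roots; as the height of ξ is the number of these roots,
-- it is also admissible for the multiplicity bound built into ℘.

module Submission where

open import Defs
open import Data.Bool using (Bool; true; false; if_then_else_; not; _∧_)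
open import Data.Bool.Properties using (¬-not)
open import Data.Fin as Fin using (Fin; toℕ; inject₁; fromℕ; punchIn)
import Data.Fin.Properties as FinP
open import Data.Fin.Permutation using (_⟨$⟩ˡ_)
import Data.Fin.Permutation.Components as PC
open import Data.Fin.Subset using (Subset; _∈_; Nonempty)
open import Data.Integer as ℤ using (ℤ; +_; -_; _+_; _-_; _*_; ∣_∣; 0ℤ; 1ℤ)
import Data.Integer.Properties as ℤP
open import Algebra.Properties.Semiring.Sum ℤP.+-*-semiring
  using (sum; sum-syntax; sum-cong-≗; ∑-comm; *-distribˡ-sum; sum-remove; sum-replicate-zero)
open import Data.Integer.Tactic.RingSolver using (solve-∀)
open import Data.List using (List; []; _∷_; [_]; map; concat; concatMap; allFin; foldr; tabulate; length; upTo)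
open import Data.List.Membership.Propositional using () renaming (_∈_ to _∈ₗ_)
open import Data.List.Membership.Propositional.Properties using (∈-allFin; ∈-map⁺; ∈-concat⁺′)
open import Data.List.Properties using (map-tabulate)
open import Data.List.Relation.Binary.Sublist.Heterogeneous using (Sublist; []; _∷_; _∷ʳ_)
open import Data.List.Relation.Binary.Sublist.Propositional using (_⊆_; minimum; from∈)
import Data.List.Relation.Binary.Sublist.Propositional.Properties as Sublist
open import Data.List.Relation.Unary.All as All using (All; []; _∷_)
import Data.List.Relation.Unary.All.Properties as All
open import Data.List.Relation.Unary.Any using (here; there)
open import Data.Nat as ℕ using (ℕ; zero; suc; _≤_; _<_; z≤n; s≤s)
import Data.Nat.ListAction as ListAction
import Data.Nat.Properties as ℕP
open import Data.Product using (∃-syntax; _,_; _×_)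
open import Data.Sum using (_⊎_; inj₁; inj₂)
open import Data.Vec using (lookup)
import Data.Vec.Properties as VecP
open import Function using (id; _∘_; _⇔_; mk⇔; Equivalence)
open import Relation.Binary.PropositionalEquality
  using (_≡_; _≢_; _≗_; refl; sym; trans; cong; cong₂; subst; subst₂; module ≡-Reasoning)
open import Relation.Nullary using (¬_; Dec; yes; no; contradiction)
open import Relation.Nullary.Decidable using (⌊_⌋)

𝟙 : Bool → ℤ
𝟙 b = if b then 1ℤ else 0ℤ

𝟙-nonneg : ∀ b → 0ℤ ℤ.≤ 𝟙 b
𝟙-nonneg true  = ℤ.+≤+ z≤n
𝟙-nonneg false = ℤ.+≤+ z≤n

δ : ∀ {n} → Fin n → Fin n → ℤ
δ i j = 𝟙 ⌊ i Fin.≟ j ⌋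

δ-≡ : ∀ {n} {i j : Fin n} → i ≡ j → δ i j ≡ 1ℤ
δ-≡ {i = i} refl with i Fin.≟ i
... | yes _  = refl
... | no i≢i = contradiction refl i≢i

δ-≢ : ∀ {n} {i j : Fin n} → i ≢ j → δ i j ≡ 0ℤ
δ-≢ {i = i} {j} i≢j with i Fin.≟ j
... | yes i≡j = contradiction i≡j i≢j
... | no _    = refl

δ-nonneg : ∀ {n} (i j : Fin n) → 0ℤ ℤ.≤ δ i j
δ-nonneg i j = 𝟙-nonneg ⌊ i Fin.≟ j ⌋

sum-eq-single : ∀ {n} (f : Fin n → ℤ) (i : Fin n) → (∀ j → j ≢ i → f j ≡ 0ℤ) → sum f ≡ f i
sum-eq-single {suc n} f i f≡0 = begin
  sum f                      ≡⟨ sum-remove {i = i} f ⟩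
  f i + sum (f ∘ punchIn i)  ≡⟨ cong (_+_ (f i)) (sum-cong-≗ (λ j → f≡0 _ (FinP.punchInᵢ≢i i j))) ⟩
  f i + ∑[ _ < n ] 0ℤ        ≡⟨ cong (_+_ (f i)) (sum-replicate-zero n) ⟩
  f i + 0ℤ                   ≡⟨ ℤP.+-identityʳ (f i) ⟩
  f i                        ∎
  where open ≡-Reasoning

sum-δ : ∀ {n} (i : Fin n) (f : Fin n → ℤ) → ∑[ j < n ] (δ i j * f j) ≡ f i
sum-δ i f = trans (sum-eq-single _ i (λ j j≢i → cong (_* f j) (δ-≢ (j≢i ∘ sym))))
                  (trans (cong (_* f i) (δ-≡ {i = i} refl)) (ℤP.*-identityˡ (f i)))

∑-distrib-- : ∀ {n} (f g : Fin n → ℤ) → ∑[ j < n ] (f j - g j) ≡ sum f - sum g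
∑-distrib-- {zero}  f g = refl
∑-distrib-- {suc n} f g =
  trans (cong (_+_ (f Fin.zero - g Fin.zero)) (∑-distrib-- (f ∘ Fin.suc) (g ∘ Fin.suc)))
        (ring (f Fin.zero) (g Fin.zero) (sum (f ∘ Fin.suc)) (sum (g ∘ Fin.suc)))
  where
  ring : ∀ a b x y → a - b + (x - y) ≡ a + x - (b + y)
  ring = solve-∀

sum-telescope : ∀ {n} (f : Fin (suc n) → ℤ) →
  ∑[ j < n ] (f (inject₁ j) - f (Fin.suc j)) ≡ f Fin.zero - f (fromℕ n)
sum-telescope {zero}  f = sym (ℤP.+-inverseʳ (f Fin.zero))
sum-telescope {suc n} f =
  trans (cong (_+_ (f Fin.zero - f (Fin.suc Fin.zero))) (sum-telescope (f ∘ Fin.suc)))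
        (ring (f Fin.zero) (f (Fin.suc Fin.zero)) (f (fromℕ (suc n))))
  where
  ring : ∀ a b c → a - b + (b - c) ≡ a - c
  ring = solve-∀

sumₗ : List ℤ → ℤ
sumₗ = foldr _+_ 0ℤ

sumₗ-map-allFin : ∀ {n} (f : Fin n → ℤ) → sumₗ (map f (allFin n)) ≡ sum f
sumₗ-map-allFin f = trans (cong sumₗ (map-tabulate id f)) (sumₗ-tabulate f)
  where
  sumₗ-tabulate : ∀ {n} (f : Fin n → ℤ) → sumₗ (tabulate f) ≡ sum f
  sumₗ-tabulate {zero}  f = refl
  sumₗ-tabulate {suc n} f = cong (_+_ (f Fin.zero)) (sumₗ-tabulate (f ∘ Fin.suc))

sumₗ-map-filter : ∀ {A : Set} {n} (p : Fin n → Bool) (g : Fin n → A) (f : A → ℤ) →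
  sumₗ (map f (concatMap (λ j → if p j then [ g j ] else []) (allFin n))) ≡ ∑[ j < n ] (𝟙 (p j) * f (g j))
sumₗ-map-filter p g f =
  trans (cong (sumₗ ∘ map f ∘ concat) (map-tabulate id (λ j → if p j then [ g j ] else [])))
        (sumₗ-concat-tabulate p g)
  where
  sumₗ-concat-tabulate : ∀ {n} (p : Fin n → Bool) (g : Fin n → _) →
    sumₗ (map f (concat (tabulate (λ j → if p j then [ g j ] else [])))) ≡ ∑[ j < n ] (𝟙 (p j) * f (g j))
  sumₗ-concat-tabulate {zero}  p g = refl
  sumₗ-concat-tabulate {suc n} p g with p Fin.zero
  ... | true  = cong₂ _+_ (sym (ℤP.*-identityˡ (f (g Fin.zero))))
                          (sumₗ-concat-tabulate (p ∘ Fin.suc) (g ∘ Fin.suc))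
  ... | false = trans (sumₗ-concat-tabulate (p ∘ Fin.suc) (g ∘ Fin.suc)) (sym (ℤP.+-identityˡ _))

⟨_,_⟩ : ∀ {r} → Wt r → Wt r → ℤ
⟨_,_⟩ {r} w ξ = ∑[ k < suc r ] (w k * ξ k)

infixr 7 _⊛_
_⊛_ : ∀ {r} → ℤ → Wt r → Wt r
(c ⊛ v) k = c * v k

sumW : ∀ {r} → List (Wt r) → Wt r
sumW = foldr _⊕_ zeroWt

⟨⟩-cong : ∀ {r} (w : Wt r) {ξ η : Wt r} → ξ ≗ η → ⟨ w , ξ ⟩ ≡ ⟨ w , η ⟩
⟨⟩-cong w ξ≗η = sum-cong-≗ (λ k → cong (w k *_) (ξ≗η k))

⟨⟩-zero : ∀ {r} (w ξ : Wt r) → ξ ≗ zeroWt → ⟨ w , ξ ⟩ ≡ 0ℤ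
⟨⟩-zero {r} w ξ ξ≗0 =
  trans (⟨⟩-cong w ξ≗0) (trans (sum-cong-≗ (λ k → ℤP.*-zeroʳ (w k))) (sum-replicate-zero (suc r)))

⟨⟩-⊖ : ∀ {r} (w u v : Wt r) → ⟨ w , u ⊖ v ⟩ ≡ ⟨ w , u ⟩ - ⟨ w , v ⟩
⟨⟩-⊖ w u v = trans (sum-cong-≗ (λ k → ring (w k) (u k) (v k)))
                   (∑-distrib-- (λ k → w k * u k) (λ k → w k * v k))
  where
  ring : ∀ a x y → a * (x - y) ≡ a * x - a * y
  ring = solve-∀

⟨⟩-⊛ : ∀ {r} (w : Wt r) c v → ⟨ w , c ⊛ v ⟩ ≡ c * ⟨ w , v ⟩
⟨⟩-⊛ w c v = trans (sum-cong-≗ (λ k → ring (w k) c (v k))) (sym (*-distribˡ-sum c (λ k → w k * v k)))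
  where
  ring : ∀ a c x → a * (c * x) ≡ c * (a * x)
  ring = solve-∀

⟨⟩-e : ∀ {r} (w : Wt r) a → ⟨ w , e a ⟩ ≡ w a
⟨⟩-e w a = trans (sum-cong-≗ (λ k → ℤP.*-comm (w k) (δ a k))) (sum-δ a w)

⟨⟩-rootE : ∀ {r} (w : Wt r) a b → ⟨ w , rootE a b ⟩ ≡ w a - w b
⟨⟩-rootE w a b = trans (⟨⟩-⊖ w (e a) (e b)) (cong₂ _-_ (⟨⟩-e w a) (⟨⟩-e w b))

isZero-sound : ∀ {r} (ξ : Wt r) → isZero ξ ≡ true → ξ ≗ zeroWt
isZero-sound {r} ξ isZero≡true k = all-zero (allFin (suc r)) isZero≡true (∈-allFin k)
  where
  all-zero : ∀ ks → foldr (λ k acc → ⌊ ξ k ℤ.≟ 0ℤ ⌋ ∧ acc) true ks ≡ true → k ∈ₗ ks → ξ k ≡ 0ℤ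
  all-zero (k′ ∷ ks) all≡true k∈ with ξ k′ ℤ.≟ 0ℤ
  all-zero (k′ ∷ ks) all≡true (here refl) | yes ξk≡0 = ξk≡0
  all-zero (k′ ∷ ks) all≡true (there k∈)  | yes _    = all-zero ks all≡true k∈

isZero-complete : ∀ {r} (ξ : Wt r) → ξ ≗ zeroWt → isZero ξ ≡ true
isZero-complete {r} ξ ξ≗0 = all-zero (allFin (suc r))
  where
  all-zero : ∀ ks → foldr (λ k acc → ⌊ ξ k ℤ.≟ 0ℤ ⌋ ∧ acc) true ks ≡ true
  all-zero []       = refl
  all-zero (k ∷ ks) with ξ k ℤ.≟ 0ℤ
  ... | yes _   = all-zero ks
  ... | no ξk≢0 = contradiction (ξ≗0 k) ξk≢0

0<sum-map⇒∃ : ∀ {A : Set} (G : A → ℕ) (xs : List A) → 0 < ListAction.sum (map G xs) → ∃[ x ] 0 < G x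
0<sum-map⇒∃ G (x ∷ xs) pos with G x in Gx≡
... | suc _ = x , subst (0 <_) (sym Gx≡) (s≤s z≤n)
... | zero  = 0<sum-map⇒∃ G xs pos

countBounded-pos⇒⟨⟩-nonneg : ∀ {r} (w : Wt r) {βs} → All (λ β → 0ℤ ℤ.≤ ⟨ w , β ⟩) βs →
  ∀ b ξ → 0 < countBounded βs b ξ → 0ℤ ℤ.≤ ⟨ w , ξ ⟩
countBounded-pos⇒⟨⟩-nonneg w [] b ξ pos with isZero ξ in isZero≡
... | true = ℤP.≤-reflexive (sym (⟨⟩-zero w ξ (isZero-sound ξ isZero≡)))
countBounded-pos⇒⟨⟩-nonneg w {β ∷ βs} (wβ≥0 ∷ wβs≥0) b ξ pos with 0<sum-map⇒∃ _ (upTo (suc b)) pos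
... | m , pos′ = begin
  0ℤ                ≡⟨ ℤP.*-zeroʳ (+ m) ⟨
  + m * 0ℤ          ≤⟨ ℤP.*-monoˡ-≤-nonNeg (+ m) wβ≥0 ⟩
  + m * ⟨ w , β ⟩   ≤⟨ ℤP.0≤i-j⇒j≤i (subst (0ℤ ℤ.≤_) rest≡ rest≥0) ⟩
  ⟨ w , ξ ⟩         ∎
  where
  open ℤP.≤-Reasoning
  rest≥0 : 0ℤ ℤ.≤ ⟨ w , ξ ⊖ (+ m ⊛ β) ⟩
  rest≥0 = countBounded-pos⇒⟨⟩-nonneg w wβs≥0 b (ξ ⊖ (+ m ⊛ β)) pos′
  rest≡ : ⟨ w , ξ ⊖ (+ m ⊛ β) ⟩ ≡ ⟨ w , ξ ⟩ - + m * ⟨ w , β ⟩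
  rest≡ = trans (⟨⟩-⊖ w ξ (+ m ⊛ β)) (cong (_-_ ⟨ w , ξ ⟩) (⟨⟩-⊛ w (+ m) β))

-- Each root of L is used exactly once, so length L ≤ b only serves to give b ≥ 1 when L ≢ [].
⊆⇒countBounded-pos : ∀ {r} {L βs : List (Wt r)} → L ⊆ βs → ∀ {b} → length L ≤ b →
  ∀ ξ → ξ ≗ sumW L → 0 < countBounded βs b ξ
⊆⇒countBounded-pos [] _ ξ ξ≗0 rewrite isZero-complete ξ ξ≗0 = s≤s z≤n
⊆⇒countBounded-pos {L = L} (β ∷ʳ L⊆βs) len ξ ξ≗ =
  ℕP.<-≤-trans (⊆⇒countBounded-pos L⊆βs len (ξ ⊖ (0ℤ ⊛ β)) ξ-0β≗) (ℕP.m≤m+n _ _)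
  where
  ξ-0β≗ : ξ ⊖ (0ℤ ⊛ β) ≗ sumW L
  ξ-0β≗ k = trans (ring (ξ k) (β k)) (ξ≗ k)
    where
    ring : ∀ x y → x - 0ℤ * y ≡ x
    ring = solve-∀
⊆⇒countBounded-pos {L = β ∷ L} {_ ∷ βs} (refl ∷ L⊆βs) {suc b} (s≤s len) ξ ξ≗ =
  ℕP.<-≤-trans (⊆⇒countBounded-pos L⊆βs (ℕP.m≤n⇒m≤1+n len) (ξ ⊖ (1ℤ ⊛ β)) ξ-β≗)
               (ℕP.≤-trans (ℕP.m≤m+n _ _) (ℕP.m≤n+m _ (countBounded βs (suc b) (ξ ⊖ (0ℤ ⊛ β)))))
  where
  ξ-β≗ : ξ ⊖ (1ℤ ⊛ β) ≗ sumW L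
  ξ-β≗ k = trans (cong (λ x → x - 1ℤ * β k) (ξ≗ k)) (ring (β k) (sumW L k))
    where
    ring : ∀ x y → (x + y) - 1ℤ * x ≡ y
    ring = solve-∀

posRoots-⟨⟩-nonneg : ∀ {r} (w : Wt r) → (∀ {a b} → a Fin.< b → w b ℤ.≤ w a) →
  All (λ β → 0ℤ ℤ.≤ ⟨ w , β ⟩) (posRoots r)
posRoots-⟨⟩-nonneg {r} w antitone =
  concatMap⁺ (λ a → concatMap⁺ (rootE-nonneg a) (allFin (suc r))) (allFin (suc r))
  where
  concatMap⁺ : ∀ {A : Set} {f : A → List (Wt r)} → (∀ x → All (λ β → 0ℤ ℤ.≤ ⟨ w , β ⟩) (f x)) →
    ∀ xs → All (λ β → 0ℤ ℤ.≤ ⟨ w , β ⟩) (concatMap f xs)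
  concatMap⁺ all-f xs = All.concat⁺ (All.map⁺ (All.universal all-f xs))
  rootE-nonneg : ∀ a b → All (λ β → 0ℤ ℤ.≤ ⟨ w , β ⟩) (if ⌊ a Fin.<? b ⌋ then [ rootE a b ] else [])
  rootE-nonneg a b with a Fin.<? b
  ... | yes a<b = subst (0ℤ ℤ.≤_) (sym (⟨⟩-rootE w a b)) (ℤP.i≤j⇒0≤j-i (antitone a<b)) ∷ []
  ... | no _    = []

ϖ : ∀ {r} → Fin r → Wt r
ϖ i k = 𝟙 ⌊ toℕ k ℕ.≤? toℕ i ⌋

ϖ-antitone : ∀ {r} (i : Fin r) {a b : Fin (suc r)} → a Fin.< b → ϖ i b ℤ.≤ ϖ i a
ϖ-antitone i {a} {b} a<b with toℕ a ℕ.≤? toℕ i | toℕ b ℕ.≤? toℕ i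
... | yes _   | yes _   = ℤP.≤-refl
... | yes _   | no _    = ℤ.+≤+ z≤n
... | no a≰i  | yes b≤i = contradiction (ℕP.≤-trans (ℕP.<⇒≤ a<b) b≤i) a≰i
... | no _    | no _    = ℤP.≤-refl

⟨ϖ,α⟩ : ∀ {r} (i j : Fin r) → ⟨ ϖ i , α j ⟩ ≡ δ i j
⟨ϖ,α⟩ i j = trans (⟨⟩-rootE (ϖ i) (inject₁ j) (Fin.suc j)) (ϖ-step i j)
  where
  ϖ-step : ∀ {r} (i j : Fin r) → ϖ i (inject₁ j) - ϖ i (Fin.suc j) ≡ δ i j
  ϖ-step i j rewrite FinP.toℕ-inject₁ j
    with toℕ j ℕ.≤? toℕ i | suc (toℕ j) ℕ.≤? toℕ i | i Fin.≟ j
  ... | _       | yes j<i | yes refl = contradiction j<i (ℕP.n≮n _)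
  ... | yes _   | yes _   | no _     = refl
  ... | yes _   | no _    | yes _    = refl
  ... | yes j≤i | no j≮i  | no i≢j   =
    contradiction (FinP.toℕ-injective (ℕP.≤-antisym (ℕP.≮⇒≥ j≮i) j≤i)) i≢j
  ... | no j≰i  | yes j<i | no _     = contradiction (ℕP.<⇒≤ j<i) j≰i
  ... | no j≰i  | no _    | yes refl = contradiction ℕP.≤-refl j≰i
  ... | no _    | no _    | no _     = refl

rootComb : ∀ {r} → (Fin r → ℤ) → Wt r
rootComb {r} c k = ∑[ j < r ] (c j * α j k)

rootComb-cong : ∀ {r} {c d : Fin r → ℤ} → c ≗ d → rootComb c ≗ rootComb d
rootComb-cong c≗d k = sum-cong-≗ (λ j → cong (_* α j k) (c≗d j))

rootComb-⊖ : ∀ {r} (c d : Fin r → ℤ) → rootComb c ⊖ rootComb d ≗ rootComb (λ j → c j - d j)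
rootComb-⊖ c d k = sym (trans (sum-cong-≗ (λ j → ring (c j) (d j) (α j k)))
                              (∑-distrib-- (λ j → c j * α j k) (λ j → d j * α j k)))
  where
  ring : ∀ c d x → (c - d) * x ≡ c * x - d * x
  ring = solve-∀

rootComb-⊛ : ∀ {r} (x : ℤ) (c : Fin r → ℤ) → x ⊛ rootComb c ≗ rootComb (λ j → x * c j)
rootComb-⊛ x c k = trans (*-distribˡ-sum x (λ j → c j * α j k))
                         (sum-cong-≗ (λ j → sym (ℤP.*-assoc x (c j) (α j k))))

⟨⟩-rootComb : ∀ {r} (w : Wt r) (c : Fin r → ℤ) → ⟨ w , rootComb c ⟩ ≡ ∑[ j < r ] (c j * ⟨ w , α j ⟩)
⟨⟩-rootComb {r} w c = begin
  ∑[ k < suc r ] (w k * ∑[ j < r ] (c j * α j k))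
    ≡⟨ sum-cong-≗ (λ k → *-distribˡ-sum (w k) (λ j → c j * α j k)) ⟩
  ∑[ k < suc r ] ∑[ j < r ] (w k * (c j * α j k))
    ≡⟨ ∑-comm (λ k j → w k * (c j * α j k)) ⟩
  ∑[ j < r ] ∑[ k < suc r ] (w k * (c j * α j k))
    ≡⟨ sum-cong-≗ (λ j → sum-cong-≗ (λ k → ring (w k) (c j) (α j k))) ⟩
  ∑[ j < r ] ∑[ k < suc r ] (c j * (w k * α j k))
    ≡⟨ sum-cong-≗ (λ j → *-distribˡ-sum (c j) (λ k → w k * α j k)) ⟨
  ∑[ j < r ] (c j * ⟨ w , α j ⟩)
    ∎
  where
  open ≡-Reasoning
  ring : ∀ a c x → a * (c * x) ≡ c * (a * x)
  ring = solve-∀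

⟨ϖ,rootComb⟩ : ∀ {r} (i : Fin r) (c : Fin r → ℤ) → ⟨ ϖ i , rootComb c ⟩ ≡ c i
⟨ϖ,rootComb⟩ i c = trans (⟨⟩-rootComb (ϖ i) c)
  (trans (sum-cong-≗ (λ j → trans (cong (c j *_) (⟨ϖ,α⟩ i j)) (ℤP.*-comm (c j) (δ i j)))) (sum-δ i c))

θ≗rootComb : ∀ r → θ r ≗ rootComb (λ _ → 1ℤ)
θ≗rootComb r k = sym (trans (sum-cong-≗ (λ j → ℤP.*-identityˡ (α j k))) (sum-telescope (λ a → e a k)))

α≗rootComb : ∀ {r} (i : Fin r) → α i ≗ rootComb (δ i)
α≗rootComb i k = sym (sum-δ i (λ j → α j k))

simpleRoots : ∀ {r} → (Fin r → Bool) → List (Wt r)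
simpleRoots {r} p = concatMap (λ j → if p j then [ α j ] else []) (allFin r)

sumW-simpleRoots : ∀ {r} (p : Fin r → Bool) → sumW (simpleRoots p) ≗ rootComb (𝟙 ∘ p)
sumW-simpleRoots p k = trans (sumW≗sumₗ (simpleRoots p)) (sumₗ-map-filter p α (λ β → β k))
  where
  sumW≗sumₗ : ∀ L → sumW L k ≡ sumₗ (map (λ β → β k) L)
  sumW≗sumₗ []      = refl
  sumW≗sumₗ (β ∷ L) = cong (_+_ (β k)) (sumW≗sumₗ L)

length-simpleRoots : ∀ {r} (p : Fin r → Bool) → + length (simpleRoots p) ≡ ∑[ j < r ] 𝟙 (p j)
length-simpleRoots p = trans (+length≡sumₗ (simpleRoots p))
  (trans (sumₗ-map-filter p α (λ _ → 1ℤ)) (sum-cong-≗ (λ j → ℤP.*-identityʳ (𝟙 (p j)))))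
  where
  +length≡sumₗ : ∀ {A : Set} (xs : List A) → + length xs ≡ sumₗ (map (λ _ → 1ℤ) xs)
  +length≡sumₗ []       = refl
  +length≡sumₗ (x ∷ xs) = cong (_+_ 1ℤ) (+length≡sumₗ xs)

αSet≗rootComb : ∀ {r} (I : Subset r) → αSet I ≗ rootComb (𝟙 ∘ lookup I)
αSet≗rootComb {r} I k = trans (αSet≗sumW (allFin r)) (sumW-simpleRoots (lookup I) k)
  where
  αSet≗sumW : ∀ js → foldr (λ j acc → if lookup I j then α j ⊕ acc else acc) zeroWt js k
                   ≡ sumW (concatMap (λ j → if lookup I j then [ α j ] else []) js) k
  αSet≗sumW []       = refl
  αSet≗sumW (j ∷ js) with lookup I j
  ... | true  = cong (_+_ (α j k)) (αSet≗sumW js)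
  ... | false = αSet≗sumW js

height≡∑⟨ϖ⟩ : ∀ {r} (ξ : Wt r) → height ξ ≡ ∑[ i < r ] ⟨ ϖ i , ξ ⟩
height≡∑⟨ϖ⟩ {r} ξ = trans (sumₗ-map-allFin (λ i → sumₗ (map ξ (prefix i)))) (sum-cong-≗ prefix-sum)
  where
  prefix : Fin r → List (Fin (suc r))
  prefix i = concatMap (λ k → if ⌊ toℕ k ℕ.≤? toℕ i ⌋ then [ k ] else []) (allFin (suc r))
  prefix-sum : ∀ i → sumₗ (map ξ (prefix i)) ≡ ⟨ ϖ i , ξ ⟩
  prefix-sum i = sumₗ-map-filter (λ k → ⌊ toℕ k ℕ.≤? toℕ i ⌋) id ξ

tabulate-inject₁⁺ : ∀ {A B : Set} {R : A → B → Set} {n} {f : Fin n → A} {g : Fin (suc n) → B} →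
  (∀ j → R (f j) (g (inject₁ j))) → Sublist R (tabulate f) (tabulate g)
tabulate-inject₁⁺ {n = zero}  _   = _ ∷ʳ []
tabulate-inject₁⁺ {n = suc n} {f} {g} Rfg =
  Rfg Fin.zero ∷ tabulate-inject₁⁺ {f = f ∘ Fin.suc} {g = g ∘ Fin.suc} (Rfg ∘ Fin.suc)

simpleRoots⊆posRoots : ∀ {r} (p : Fin r → Bool) → simpleRoots p ⊆ posRoots r
simpleRoots⊆posRoots {r} p =
  Sublist.concat⁺ (subst₂ (Sublist _⊆_) (sym (map-tabulate id block)) (sym (map-tabulate id rootsFrom))
                          (tabulate-inject₁⁺ {f = block} {g = rootsFrom} block⊆))
  where
  block : Fin r → List (Wt r)
  block j = if p j then [ α j ] else []
  rootsFrom : Fin (suc r) → List (Wt r)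
  rootsFrom a = concatMap (λ b → if ⌊ a Fin.<? b ⌋ then [ rootE a b ] else []) (allFin (suc r))
  α∈rootsFrom : ∀ j → α j ∈ₗ rootsFrom (inject₁ j)
  α∈rootsFrom j = ∈-concat⁺′ α∈ (∈-map⁺ (λ b → if ⌊ inject₁ j Fin.<? b ⌋ then [ rootE (inject₁ j) b ] else [])
                                          (∈-allFin (Fin.suc j)))
    where
    α∈ : α j ∈ₗ (if ⌊ inject₁ j Fin.<? Fin.suc j ⌋ then [ α j ] else [])
    α∈ with inject₁ j Fin.<? Fin.suc j
    ... | yes _ = here refl
    ... | no j≮ = contradiction (FinP.≤̄⇒inject₁< FinP.≤-refl) j≮
  block⊆ : ∀ j → block j ⊆ rootsFrom (inject₁ j)
  block⊆ j with p j
  ... | true  = from∈ (α∈rootsFrom j)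
  ... | false = minimum _

℘-pos-on-simpleRootSums : ∀ {r} (p : Fin r → Bool) (ξ : Wt r) → ξ ≗ rootComb (𝟙 ∘ p) → 0 < ℘ ξ
℘-pos-on-simpleRootSums {r} p ξ ξ≗ =
  ⊆⇒countBounded-pos (simpleRoots⊆posRoots p) (ℕP.≤-reflexive (cong ∣_∣ (sym height≡))) ξ
    (λ k → trans (ξ≗ k) (sym (sumW-simpleRoots p k)))
  where
  height≡ : height ξ ≡ + length (simpleRoots p)
  height≡ = begin
    height ξ                  ≡⟨ height≡∑⟨ϖ⟩ ξ ⟩
    ∑[ i < r ] ⟨ ϖ i , ξ ⟩    ≡⟨ sum-cong-≗ (λ i → trans (⟨⟩-cong (ϖ i) ξ≗) (⟨ϖ,rootComb⟩ i (𝟙 ∘ p))) ⟩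
    ∑[ i < r ] 𝟙 (p i)        ≡⟨ length-simpleRoots p ⟨
    + length (simpleRoots p)  ∎
    where open ≡-Reasoning

transpose-matchˡ : ∀ {n} (i j : Fin n) → PC.transpose i j i ≡ j
transpose-matchˡ i j with i Fin.≟ i
... | yes _  = refl
... | no i≢i = contradiction refl i≢i

transpose-matchʳ : ∀ {n} (i j : Fin n) → PC.transpose i j j ≡ i
transpose-matchʳ i j with j Fin.≟ i
... | yes j≡i = j≡i
... | no _ with j Fin.≟ j
...   | yes _  = refl
...   | no j≢j = contradiction refl j≢j

transpose-other : ∀ {n} {i j k : Fin n} → k ≢ i → k ≢ j → PC.transpose i j k ≡ k
transpose-other {i = i} {j} {k} k≢i k≢j with k Fin.≟ i
... | yes k≡i = contradiction k≡i k≢i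
... | no _ with k Fin.≟ j
...   | yes k≡j = contradiction k≡j k≢j
...   | no _    = refl

inject₁≢suc : ∀ {r} (i : Fin r) → inject₁ i ≢ Fin.suc i
inject₁≢suc i eq = ℕP.<-irrefl (cong toℕ eq) (FinP.≤̄⇒inject₁< FinP.≤-refl)

⟨_,α∨_⟩ : ∀ {r} → Wt r → Fin r → ℤ
⟨ v ,α∨ i ⟩ = v (inject₁ i) - v (Fin.suc i)

s-reflection : ∀ {r} (i : Fin r) (v : Wt r) → s i · v ≗ v ⊖ (⟨ v ,α∨ i ⟩ ⊛ α i)
s-reflection {r} i v k = by-cases k (k Fin.≟ a) (k Fin.≟ b)
  where
  open ≡-Reasoning
  a b : Fin (suc r)
  a = inject₁ i
  b = Fin.suc i
  by-cases : ∀ k → Dec (k ≡ a) → Dec (k ≡ b) → (s i · v) k ≡ v k - ⟨ v ,α∨ i ⟩ * α i k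
  by-cases _ (yes refl) _ = begin
    v (s i ⟨$⟩ˡ a)                ≡⟨ cong v (transpose-matchʳ b a) ⟩
    v b                           ≡⟨ ring (v a) (v b) ⟩
    v a - ⟨ v ,α∨ i ⟩ * (1ℤ - 0ℤ)  ≡⟨ cong (λ x → v a - ⟨ v ,α∨ i ⟩ * x)
                                        (cong₂ _-_ (δ-≡ {i = a} refl) (δ-≢ (inject₁≢suc i ∘ sym))) ⟨
    v a - ⟨ v ,α∨ i ⟩ * α i a     ∎
    where
    ring : ∀ x y → y ≡ x - (x - y) * (1ℤ - 0ℤ)
    ring = solve-∀
  by-cases _ (no _) (yes refl) = begin
    v (s i ⟨$⟩ˡ b)                ≡⟨ cong v (transpose-matchˡ b a) ⟩
    v a                           ≡⟨ ring (v a) (v b) ⟩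
    v b - ⟨ v ,α∨ i ⟩ * (0ℤ - 1ℤ)  ≡⟨ cong (λ x → v b - ⟨ v ,α∨ i ⟩ * x)
                                        (cong₂ _-_ (δ-≢ (inject₁≢suc i)) (δ-≡ {i = b} refl)) ⟨
    v b - ⟨ v ,α∨ i ⟩ * α i b     ∎
    where
    ring : ∀ x y → x ≡ y - (x - y) * (0ℤ - 1ℤ)
    ring = solve-∀
  by-cases k (no k≢a) (no k≢b) = begin
    v (s i ⟨$⟩ˡ k)                ≡⟨ cong v (transpose-other k≢b k≢a) ⟩
    v k                           ≡⟨ ring (v k) ⟨ v ,α∨ i ⟩ ⟩
    v k - ⟨ v ,α∨ i ⟩ * (0ℤ - 0ℤ)  ≡⟨ cong (λ x → v k - ⟨ v ,α∨ i ⟩ * x)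
                                        (cong₂ _-_ (δ-≢ (k≢a ∘ sym)) (δ-≢ (k≢b ∘ sym))) ⟨
    v k - ⟨ v ,α∨ i ⟩ * α i k     ∎
    where
    ring : ∀ x c → x ≡ x - c * (0ℤ - 0ℤ)
    ring = solve-∀

_•_ : ∀ {r} → W r → Wt r → Wt r
_•_ {r} σ v = (σ · (v ⊕ ρ r)) ⊖ ρ r

ρ-step : ∀ {r} (i : Fin r) → ρ r (inject₁ i) ≡ 1ℤ + ρ r (Fin.suc i)
ρ-step {r} i = cong +_ (trans (cong (r ℕ.∸_) (FinP.toℕ-inject₁ i)) (ℕP.+-∸-assoc 1 (FinP.toℕ<n i)))

s•-reflection : ∀ {r} (i : Fin r) (v : Wt r) → s i • v ≗ v ⊖ ((⟨ v ,α∨ i ⟩ + 1ℤ) ⊛ α i)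
s•-reflection {r} i v k = begin
  (s i · (v ⊕ ρ r)) k - ρ r k
    ≡⟨ cong (_- ρ r k) (s-reflection i (v ⊕ ρ r) k) ⟩
  (v k + ρ r k) - ((v a + ρ r a) - (v b + ρ r b)) * α i k - ρ r k
    ≡⟨ cong (λ x → (v k + ρ r k) - ((v a + x) - (v b + ρ r b)) * α i k - ρ r k) (ρ-step i) ⟩
  (v k + ρ r k) - ((v a + (1ℤ + ρ r b)) - (v b + ρ r b)) * α i k - ρ r k
    ≡⟨ ring (v k) (ρ r k) (v a) (v b) (ρ r b) (α i k) ⟩
  v k - (⟨ v ,α∨ i ⟩ + 1ℤ) * α i k
    ∎
  where
  open ≡-Reasoning
  a b : Fin (suc r)
  a = inject₁ i
  b = Fin.suc i
  ring : ∀ x ρk xa xb ρb y → (x + ρk) - ((xa + (1ℤ + ρb)) - (xb + ρb)) * y - ρk ≡ x - (xa - xb + 1ℤ) * y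
  ring = solve-∀

zero≡inject₁⇔toℕ≡0 : ∀ {r} (i : Fin r) → Fin.zero ≡ inject₁ i ⇔ toℕ i ≡ 0
zero≡inject₁⇔toℕ≡0 i = mk⇔ (λ eq → trans (sym (FinP.toℕ-inject₁ i)) (cong toℕ (sym eq)))
                           (λ i≡0 → FinP.toℕ-injective (sym (trans (FinP.toℕ-inject₁ i) i≡0)))

fromℕ≡suc⇔suc-toℕ≡ : ∀ {r} (i : Fin r) → fromℕ r ≡ Fin.suc i ⇔ suc (toℕ i) ≡ r
fromℕ≡suc⇔suc-toℕ≡ {r} i = mk⇔ (λ eq → trans (cong toℕ (sym eq)) (FinP.toℕ-fromℕ r))
                               (λ eq → FinP.toℕ-injective (trans (FinP.toℕ-fromℕ r) (sym eq)))

⟨θ,α∨⟩≡ : ∀ {r} (i : Fin r) → ⟨ θ r ,α∨ i ⟩ ≡ δ Fin.zero (inject₁ i) + δ (fromℕ r) (Fin.suc i)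
⟨θ,α∨⟩≡ {r} i =
  trans (cong (λ x → (δ Fin.zero (inject₁ i) - x) - (0ℤ - δ (fromℕ r) (Fin.suc i)))
              (δ-≢ FinP.fromℕ≢inject₁))
        (ring (δ Fin.zero (inject₁ i)) (δ (fromℕ r) (Fin.suc i)))
  where
  ring : ∀ x y → (x - 0ℤ) - (0ℤ - y) ≡ x + y
  ring = solve-∀

⟨θ,α∨⟩-nonneg : ∀ {r} (i : Fin r) → 0ℤ ℤ.≤ ⟨ θ r ,α∨ i ⟩
⟨θ,α∨⟩-nonneg {r} i =
  subst (0ℤ ℤ.≤_) (sym (⟨θ,α∨⟩≡ i)) (ℤP.+-mono-≤ (δ-nonneg Fin.zero (inject₁ i)) (δ-nonneg (fromℕ r) (Fin.suc i)))

⟨θ,α∨⟩-boundary : ∀ {r} (i : Fin r) → toℕ i ≡ 0 ⊎ suc (toℕ i) ≡ r → 1ℤ ℤ.≤ ⟨ θ r ,α∨ i ⟩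
⟨θ,α∨⟩-boundary {r} i boundary = subst (1ℤ ℤ.≤_) (sym (⟨θ,α∨⟩≡ i)) (by-cases boundary)
  where
  by-cases : toℕ i ≡ 0 ⊎ suc (toℕ i) ≡ r → 1ℤ ℤ.≤ δ Fin.zero (inject₁ i) + δ (fromℕ r) (Fin.suc i)
  by-cases (inj₁ i≡0)   = ℤP.+-mono-≤ (ℤP.≤-reflexive (sym (δ-≡ (Equivalence.from (zero≡inject₁⇔toℕ≡0 i) i≡0))))
                                      (δ-nonneg (fromℕ r) (Fin.suc i))
  by-cases (inj₂ i≡r-1) = ℤP.+-mono-≤ (δ-nonneg Fin.zero (inject₁ i))
                                      (ℤP.≤-reflexive (sym (δ-≡ (Equivalence.from (fromℕ≡suc⇔suc-toℕ≡ i) i≡r-1))))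

⟨θ,α∨⟩-interior : ∀ {r} (i : Fin r) → toℕ i ≢ 0 → suc (toℕ i) ≢ r → ⟨ θ r ,α∨ i ⟩ ≡ 0ℤ
⟨θ,α∨⟩-interior i i≢0 i≢r-1 =
  trans (⟨θ,α∨⟩≡ i) (cong₂ _+_ (δ-≢ (i≢0 ∘ Equivalence.to (zero≡inject₁⇔toℕ≡0 i)))
                               (δ-≢ (i≢r-1 ∘ Equivalence.to (fromℕ≡suc⇔suc-toℕ≡ i))))

s•θ-αSet≗rootComb : ∀ {r} (i : Fin r) (I : Subset r) →
  (s i • θ r) ⊖ αSet I ≗ rootComb (λ j → 1ℤ - (⟨ θ r ,α∨ i ⟩ + 1ℤ) * δ i j - 𝟙 (lookup I j))
s•θ-αSet≗rootComb {r} i I k = begin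
  (s i • θ r) k - αSet I k
    ≡⟨ cong₂ _-_ (s•-reflection i (θ r) k) (αSet≗rootComb I k) ⟩
  θ r k - c * α i k - rootComb 𝟙I k
    ≡⟨ cong (_- rootComb 𝟙I k) (cong₂ (λ x y → x - c * y) (θ≗rootComb r k) (α≗rootComb i k)) ⟩
  rootComb 𝟏 k - c * rootComb (δ i) k - rootComb 𝟙I k
    ≡⟨ cong (λ x → rootComb 𝟏 k - x - rootComb 𝟙I k) (rootComb-⊛ c (δ i) k) ⟩
  rootComb 𝟏 k - rootComb (λ j → c * δ i j) k - rootComb 𝟙I k
    ≡⟨ cong (_- rootComb 𝟙I k) (rootComb-⊖ 𝟏 (λ j → c * δ i j) k) ⟩
  rootComb (λ j → 1ℤ - c * δ i j) k - rootComb 𝟙I k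
    ≡⟨ rootComb-⊖ (λ j → 1ℤ - c * δ i j) 𝟙I k ⟩
  rootComb (λ j → 1ℤ - c * δ i j - 𝟙 (lookup I j)) k
    ∎
  where
  open ≡-Reasoning
  c : ℤ
  c = ⟨ θ r ,α∨ i ⟩ + 1ℤ
  𝟏 𝟙I : Fin r → ℤ
  𝟏 _ = 1ℤ
  𝟙I = 𝟙 ∘ lookup I

⟨ϖ,s•θ-αSet⟩ : ∀ {r} (i : Fin r) (I : Subset r) →
  ⟨ ϖ i , (s i • θ r) ⊖ αSet I ⟩ ≡ - (⟨ θ r ,α∨ i ⟩ + 𝟙 (lookup I i))
⟨ϖ,s•θ-αSet⟩ {r} i I = begin
  ⟨ ϖ i , (s i • θ r) ⊖ αSet I ⟩
    ≡⟨ ⟨⟩-cong (ϖ i) (s•θ-αSet≗rootComb i I) ⟩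
  ⟨ ϖ i , rootComb κ ⟩
    ≡⟨ ⟨ϖ,rootComb⟩ i κ ⟩
  1ℤ - (⟨ θ r ,α∨ i ⟩ + 1ℤ) * δ i i - 𝟙 (lookup I i)
    ≡⟨ cong (λ x → 1ℤ - (⟨ θ r ,α∨ i ⟩ + 1ℤ) * x - 𝟙 (lookup I i)) (δ-≡ {i = i} refl) ⟩
  1ℤ - (⟨ θ r ,α∨ i ⟩ + 1ℤ) * 1ℤ - 𝟙 (lookup I i)
    ≡⟨ ring ⟨ θ r ,α∨ i ⟩ (𝟙 (lookup I i)) ⟩
  - (⟨ θ r ,α∨ i ⟩ + 𝟙 (lookup I i))
    ∎
  where
  open ≡-Reasoning
  κ : Fin r → ℤ
  κ j = 1ℤ - (⟨ θ r ,α∨ i ⟩ + 1ℤ) * δ i j - 𝟙 (lookup I j)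
  ring : ∀ x y → 1ℤ - (x + 1ℤ) * 1ℤ - y ≡ - (x + y)
  ring = solve-∀

s∉𝒜 : ∀ {r} (i : Fin r) (I : Subset r) →
  1ℤ ℤ.≤ ⟨ θ r ,α∨ i ⟩ + 𝟙 (lookup I i) → ¬ (s i ∈𝒜[ θ r , αSet I ])
s∉𝒜 {r} i I 1≤d s∈𝒜 = contradiction (ℤP.≤-trans 1≤d d≤0) λ { (ℤ.+≤+ ()) }
  where
  ⟨ϖ⟩≥0 : 0ℤ ℤ.≤ ⟨ ϖ i , (s i • θ r) ⊖ αSet I ⟩
  ⟨ϖ⟩≥0 = countBounded-pos⇒⟨⟩-nonneg (ϖ i) (posRoots-⟨⟩-nonneg (ϖ i) (ϖ-antitone i)) _ _ s∈𝒜
  d≤0 : ⟨ θ r ,α∨ i ⟩ + 𝟙 (lookup I i) ℤ.≤ 0ℤ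
  d≤0 = subst (ℤ._≤ 0ℤ) (ℤP.neg-involutive _)
              (ℤP.neg-mono-≤ (subst (0ℤ ℤ.≤_) (⟨ϖ,s•θ-αSet⟩ i I) ⟨ϖ⟩≥0))

s∈𝒜 : ∀ {r} (i : Fin r) (I : Subset r) →
  ⟨ θ r ,α∨ i ⟩ ≡ 0ℤ → lookup I i ≡ false → s i ∈𝒜[ θ r , αSet I ]
s∈𝒜 {r} i I θα∨≡0 i∉I =
  ℘-pos-on-simpleRootSums J _ (λ k → trans (s•θ-αSet≗rootComb i I k) (rootComb-cong coefficient k))
  where
  J : Fin r → Bool
  J j = not (lookup I j) ∧ not ⌊ i Fin.≟ j ⌋
  coefficient : ∀ j → 1ℤ - (⟨ θ r ,α∨ i ⟩ + 1ℤ) * δ i j - 𝟙 (lookup I j) ≡ 𝟙 (J j)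
  coefficient j rewrite θα∨≡0 with lookup I j in I∋j | i Fin.≟ j
  ... | true  | yes refl = contradiction (trans (sym I∋j) i∉I) λ ()
  ... | true  | no _     = refl
  ... | false | yes _    = refl
  ... | false | no _     = refl

proposition2p1 : (r : ℕ) → 1 ≤ r → (I : Subset r) → Nonempty I → (i : Fin r) →
    ((i ∈ I ⊎ toℕ i ≡ 0 ⊎ suc (toℕ i) ≡ r) → ¬ (s i ∈𝒜[ θ r , αSet I ]))
    × (¬ (i ∈ I ⊎ toℕ i ≡ 0 ⊎ suc (toℕ i) ≡ r) → s i ∈𝒜[ θ r , αSet I ])
proposition2p1 r _ I _ i = s∉𝒜 i I ∘ defect≥1 , λ ¬h →
  s∈𝒜 i I (⟨θ,α∨⟩-interior i (¬h ∘ inj₂ ∘ inj₁) (¬h ∘ inj₂ ∘ inj₂))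
          (¬-not (¬h ∘ inj₁ ∘ VecP.lookup⇒[]= i I))
  where
  defect≥1 : i ∈ I ⊎ toℕ i ≡ 0 ⊎ suc (toℕ i) ≡ r → 1ℤ ℤ.≤ ⟨ θ r ,α∨ i ⟩ + 𝟙 (lookup I i)
  defect≥1 (inj₁ i∈I)     =
    ℤP.+-mono-≤ (⟨θ,α∨⟩-nonneg i) (ℤP.≤-reflexive (sym (cong 𝟙 (VecP.[]=⇒lookup i∈I))))
  defect≥1 (inj₂ boundary) = ℤP.+-mono-≤ (⟨θ,α∨⟩-boundary i boundary) (𝟙-nonneg (lookup I i))
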